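{- Let $f:\{ -1,1\}^n\to\{ -1,1\}$ and $p\in(0,1)$. Let $\mathbf{x}$ be uniform on $\{ -1,1\}^n$ and $\mathbf{y}$ a $p$-noisy copy of $\mathbf{x}$, and for $i\in[n]$ define \[\boldsymbol{\eta}_i=\mathbf{1}[f(\mathbf{x})\ne f(\mathbf{y})]\cdot\Big(1-\frac{1}{1-\frac p2}\cdot\mathbf{1}[\mathbf{x}_i=\mathbf{y}_i]\Big).\] Then $\mathbb{E}_{\mathbf{x},\mathbf{y}}[\boldsymbol{\eta}_i]=\mathrm{Score}_i(f,p)$ for all $i\in[n]$.
   Context: A $p$-noisy copy $\mathbf{y}$ of $\mathbf{x}$ is obtained by independently rerandomizing each coordinate of $\mathbf{x}$ with probability $p$ (replacing it by a fresh uniform bit). $\mathrm{NS}_p(f)=\Pr[f(\mathbf{x})\ne f(\mathbf{y})]$. $\mathrm{Score}_i(f,p)=\mathrm{NS}_p(f)-\mathbb{E}_{\mathbf{b}\in\{ -1,1\}}[\mathrm{NS}_p(f_{x_i=\mathbf{b}})]$, where $f_{x_i=b}$ is the restriction of $f$ setting $x_i=b$ and $\mathbf{b}$ is uniform.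
   Formalization: The parameter $p$ ranges over the rationals in $(0,1)$. -}

module Defs where

open import Data.Bool using (Bool; true; false; if_then_else_)
import Data.Bool as B
open import Data.Nat using (ℕ; zero; suc)
open import Data.Fin using (Fin)
open import Data.Vec using (Vec; []; _∷_; lookup; updateAt; zipWith)
open import Data.List using (List; []; _∷_; map; concatMap; foldr)
open import Data.Rational using (ℚ; 0ℚ; 1ℚ; ½; _+_; _*_; _-_; 1/_; _≟_; ≢-nonZero)
open import Relation.Nullary using (yes; no; does)

-- Encoding: a point of {-1,1}^n is a Vec Bool n (true ↔ 1, false ↔ -1);
-- a Boolean function f : {-1,1}^n → {-1,1} is a map Vec Bool n → Bool.
Cube : ℕ → Set
Cube n = Vec Bool n

allPoints : (n : ℕ) → List (Cube n)
allPoints zero    = [] ∷ []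
allPoints (suc n) = concatMap (λ v → (true ∷ v) ∷ (false ∷ v) ∷ []) (allPoints n)

sumℚ : List ℚ → ℚ
sumℚ = foldr _+_ 0ℚ

halfPow : ℕ → ℚ
halfPow zero    = 1ℚ
halfPow (suc n) = ½ * halfPow n

Eunif : (n : ℕ) → (Cube n → ℚ) → ℚ
Eunif n g = halfPow n * sumℚ (map g (allPoints n))

-- probability of a rerandomization pattern r : r_i = true means coordinate i
-- is rerandomized (independently, each with probability p)
patternProb : ℚ → {n : ℕ} → Vec Bool n → ℚ
patternProb p []      = 1ℚ
patternProb p (r ∷ rs) = (if r then p else 1ℚ - p) * patternProb p rs

noisyCopy : {n : ℕ} → Cube n → Vec Bool n → Cube n → Cube n
noisyCopy []       []       []       = []
noisyCopy (x ∷ xs) (r ∷ rs) (b ∷ bs) = (if r then b else x) ∷ noisyCopy xs rs bs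

-- expectation over (x, y) with x uniform and y a p-noisy copy of x:
-- sum over x, pattern r and fresh uniform bits b
Enoisy : ℚ → (n : ℕ) → (Cube n → Cube n → ℚ) → ℚ
Enoisy p n g =
  Eunif n (λ x →
    sumℚ (map (λ r → patternProb p r *
                 Eunif n (λ b → g x (noisyCopy x r b)))
              (allPoints n)))

neqInd : Bool → Bool → ℚ
neqInd a c = if does (a B.≟ c) then 0ℚ else 1ℚ

eqInd : Bool → Bool → ℚ
eqInd a c = if does (a B.≟ c) then 1ℚ else 0ℚ

NS : ℚ → (n : ℕ) → (Cube n → Bool) → ℚ
NS p n f = Enoisy p n (λ x y → neqInd (f x) (f y))

-- restriction f_{x_i = b}, viewed as a function on {-1,1}^n ignoring coordinate i
restrict : {n : ℕ} → (Cube n → Bool) → Fin n → Bool → Cube n → Bool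
restrict f i b x = f (updateAt x i (λ _ → b))

Score : (n : ℕ) → (Cube n → Bool) → Fin n → ℚ → ℚ
Score n f i p = NS p n f - ½ * (NS p n (restrict f i true) + NS p n (restrict f i false))

-- 1/(1 - p/2); the (unreachable for p ∈ (0,1)) case 1 - p/2 = 0 returns 0
invOneMinusHalf : ℚ → ℚ
invOneMinusHalf p with (1ℚ - ½ * p) ≟ 0ℚ
... | yes _  = 0ℚ
... | no ne  = 1/_ (1ℚ - ½ * p) {{≢-nonZero ne}}

eta : {n : ℕ} → (Cube n → Bool) → ℚ → Fin n → Cube n → Cube n → ℚ
eta f p i x y = neqInd (f x) (f y) * (1ℚ - invOneMinusHalf p * eqInd (lookup x i) (lookup y i))

-- The pair (x_i, y_i) is independent of the other coordinates of (x, y): it is a uniform bit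
-- together with its p-noisy copy. Hence weighting by 1[x_i = y_i] multiplies by
-- Pr[x_i = y_i] = 1 - p/2 and, given x_i = y_i = b, the other coordinates form a uniform point
-- with a p-noisy copy, which is exactly the experiment defining NS_p(f_{x_i=b}). So
-- E[1[f(x) ≠ f(y)] 1[x_i = y_i]] = (1 - p/2) E_b[NS_p(f_{x_i=b})], and the identity follows
-- by linearity of expectation.
module Submission where

open import Defs
open import Data.Bool using (Bool; true; false)
open import Data.Fin using (Fin; zero; suc)
open import Data.List using (List; []; _∷_; map; concatMap)
open import Data.Nat using (ℕ; zero; suc)
open import Data.Rational using (ℚ; 0ℚ; 1ℚ; ½; _+_; _*_; _-_; -_; _<_; _≟_; ≢-nonZero)
open import Data.Rational.Properties
  using (*-assoc; *-distribˡ-+; *-zeroʳ; *-identityˡ; *-inverseˡ; _<?_)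
open import Data.Rational.Solver using (module +-*-Solver)
open import Data.Vec using (_∷_; lookup; _[_]≔_)
open import Data.Vec.Properties using (lookup∘updateAt)
open import Function using (_∘_)
open import Relation.Binary.PropositionalEquality
  using (_≡_; refl; sym; trans; cong; cong₂; subst; module ≡-Reasoning)
open import Relation.Nullary using (yes; no; contradiction)
open import Relation.Nullary.Decidable using (from-no)

open +-*-Solver
open ≡-Reasoning

record IsLinear {A : Set} (E : (A → ℚ) → ℚ) : Set where
  field
    ext         : ∀ {h₁ h₂} → (∀ a → h₁ a ≡ h₂ a) → E h₁ ≡ E h₂
    additive    : ∀ h₁ h₂ → E (λ a → h₁ a + h₂ a) ≡ E h₁ + E h₂
    homogeneous : ∀ c h → E (λ a → c * h a) ≡ c * E h

  average : ∀ h₁ h₂ → E (λ a → ½ * (h₁ a + h₂ a)) ≡ ½ * (E h₁ + E h₂)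
  average h₁ h₂ = trans (homogeneous ½ _) (cong (½ *_) (additive h₁ h₂))

module _ {A : Set} where

  sum-isLinear : (L : List A) → IsLinear (λ h → sumℚ (map h L))
  sum-isLinear L = record { ext = ext L ; additive = additive L ; homogeneous = homogeneous L }
    where
    ext : ∀ L {h₁ h₂ : A → ℚ} → (∀ a → h₁ a ≡ h₂ a) →
      sumℚ (map h₁ L) ≡ sumℚ (map h₂ L)
    ext []      eq = refl
    ext (a ∷ L) eq = cong₂ _+_ (eq a) (ext L eq)

    additive : ∀ L (h₁ h₂ : A → ℚ) →
      sumℚ (map (λ a → h₁ a + h₂ a) L) ≡ sumℚ (map h₁ L) + sumℚ (map h₂ L)
    additive []      h₁ h₂ = refl
    additive (a ∷ L) h₁ h₂ = trans (cong ((h₁ a + h₂ a) +_) (additive L h₁ h₂))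
      (solve 4 (λ x y u v → (x :+ y) :+ (u :+ v) := (x :+ u) :+ (y :+ v)) refl (h₁ a) (h₂ a) _ _)

    homogeneous : ∀ L c (h : A → ℚ) → sumℚ (map (λ a → c * h a) L) ≡ c * sumℚ (map h L)
    homogeneous []      c h = sym (*-zeroʳ c)
    homogeneous (a ∷ L) c h =
      trans (cong ((c * h a) +_) (homogeneous L c h)) (sym (*-distribˡ-+ c (h a) _))

  scale-isLinear : ∀ {E} (c : ℚ) → IsLinear E → IsLinear {A} (λ h → c * E h)
  scale-isLinear {E} c lin = record
    { ext         = cong (c *_) ∘ ext
    ; additive    = λ h₁ h₂ → trans (cong (c *_) (additive h₁ h₂)) (*-distribˡ-+ c _ _)
    ; homogeneous = λ d h → trans (cong (c *_) (homogeneous d h))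
        (solve 3 (λ x y z → x :* (y :* z) := y :* (x :* z)) refl c d (E h))
    }
    where open IsLinear lin

  weight-isLinear : ∀ {E} (w : A → ℚ) → IsLinear E → IsLinear (λ h → E (λ a → w a * h a))
  weight-isLinear w lin = record
    { ext         = λ eq → ext (λ a → cong (w a *_) (eq a))
    ; additive    = λ h₁ h₂ → trans (ext (λ a → *-distribˡ-+ (w a) (h₁ a) (h₂ a))) (additive _ _)
    ; homogeneous = λ c h → trans (ext (λ a →
        solve 3 (λ x y z → x :* (y :* z) := y :* (x :* z)) refl (w a) c (h a))) (homogeneous c _)
    }
    where open IsLinear lin

  precompose-isLinear : ∀ {B : Set} {E} (φ : B → A) → IsLinear E →
    IsLinear (λ h → E (λ b → h (φ b)))
  precompose-isLinear φ lin = record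
    { ext         = λ eq → ext (eq ∘ φ)
    ; additive    = λ h₁ h₂ → additive (h₁ ∘ φ) (h₂ ∘ φ)
    ; homogeneous = λ c h → homogeneous c (h ∘ φ)
    }
    where open IsLinear lin

  mixture-isLinear : ∀ {B : Set} {E} {F : A → (B → ℚ) → ℚ} →
    IsLinear E → (∀ a → IsLinear (F a)) → IsLinear (λ h → E (λ a → F a h))
  mixture-isLinear lin linF = record
    { ext         = λ eq → ext (λ a → IsLinear.ext (linF a) eq)
    ; additive    = λ h₁ h₂ → trans (ext (λ a → IsLinear.additive (linF a) h₁ h₂)) (additive _ _)
    ; homogeneous = λ c h → trans (ext (λ a → IsLinear.homogeneous (linF a) c h)) (homogeneous c _)
    }
    where open IsLinear lin

sum-concatMap-pair : ∀ {A B : Set} (u w : A → B) (h : B → ℚ) (L : List A) →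
  sumℚ (map h (concatMap (λ a → u a ∷ w a ∷ []) L))
  ≡ sumℚ (map (h ∘ u) L) + sumℚ (map (h ∘ w) L)
sum-concatMap-pair u w h []      = refl
sum-concatMap-pair u w h (a ∷ L) =
  trans (cong (λ s → h (u a) + (h (w a) + s)) (sum-concatMap-pair u w h L))
    (solve 4 (λ x y s t → x :+ (y :+ (s :+ t)) := (x :+ s) :+ (y :+ t)) refl (h (u a)) (h (w a)) _ _)

sum-allPoints-suc : ∀ n (h : Cube (suc n) → ℚ) →
  sumℚ (map h (allPoints (suc n))) ≡
  sumℚ (map (h ∘ (true ∷_)) (allPoints n)) + sumℚ (map (h ∘ (false ∷_)) (allPoints n))
sum-allPoints-suc n h = sum-concatMap-pair (true ∷_) (false ∷_) h (allPoints n)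

Eunif-isLinear : ∀ n → IsLinear (Eunif n)
Eunif-isLinear n = scale-isLinear (halfPow n) (sum-isLinear (allPoints n))

Eunif-suc : ∀ n (h : Cube (suc n) → ℚ) →
  Eunif (suc n) h ≡ ½ * (Eunif n (h ∘ (true ∷_)) + Eunif n (h ∘ (false ∷_)))
Eunif-suc n h = trans (cong ((½ * halfPow n) *_) (sum-allPoints-suc n h))
  (solve 3 (λ c s t → (con ½ :* c) :* (s :+ t) := con ½ :* (c :* s :+ c :* t)) refl (halfPow n) _ _)

Epattern : ℚ → (n : ℕ) → (Cube n → ℚ) → ℚ
Epattern p n G = sumℚ (map (λ r → patternProb p r * G r) (allPoints n))

Epattern-isLinear : ∀ p n → IsLinear (Epattern p n)
Epattern-isLinear p n = weight-isLinear (patternProb p) (sum-isLinear (allPoints n))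

Epattern-suc : ∀ p n (G : Cube (suc n) → ℚ) →
  Epattern p (suc n) G
  ≡ p * Epattern p n (G ∘ (true ∷_)) + (1ℚ - p) * Epattern p n (G ∘ (false ∷_))
Epattern-suc p n G =
  trans (sum-allPoints-suc n (λ r → patternProb p r * G r)) (cong₂ _+_ (pull p) (pull (1ℚ - p)))
  where
  open IsLinear (sum-isLinear (allPoints n))
  pull : ∀ {b} (c : ℚ) → sumℚ (map (λ r → (c * patternProb p r) * G (b ∷ r)) (allPoints n))
                       ≡ c * Epattern p n (G ∘ (b ∷_))
  pull c = trans (ext (λ r → *-assoc c (patternProb p r) _)) (homogeneous c _)

Ecopy : ℚ → (n : ℕ) → Cube n → (Cube n → ℚ) → ℚ
Ecopy p n x h = Epattern p n (λ r → Eunif n (λ b → h (noisyCopy x r b)))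

Ecopy-isLinear : ∀ p n x → IsLinear (Ecopy p n x)
Ecopy-isLinear p n x = mixture-isLinear (Epattern-isLinear p n)
  (λ r → precompose-isLinear (noisyCopy x r) (Eunif-isLinear n))

EcopyBit : ℚ → Bool → (Bool → ℚ) → ℚ
EcopyBit p a k = p * (½ * (k true + k false)) + (1ℚ - p) * k a

EnoisyBit : ℚ → (Bool → Bool → ℚ) → ℚ
EnoisyBit p h = ½ * (EcopyBit p true (h true) + EcopyBit p false (h false))

commute-EcopyBit : ∀ {A : Set} {E} → IsLinear {A} E → ∀ p a (k : Bool → A → ℚ) →
  E (λ x → EcopyBit p a (λ c → k c x)) ≡ EcopyBit p a (λ c → E (k c))
commute-EcopyBit {E = E} lin p a k = begin
  E (λ x → p * (½ * (k true x + k false x)) + (1ℚ - p) * k a x)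
    ≡⟨ additive _ _ ⟩
  E (λ x → p * (½ * (k true x + k false x))) + E (λ x → (1ℚ - p) * k a x)
    ≡⟨ cong₂ _+_ (homogeneous p _) (homogeneous (1ℚ - p) (k a)) ⟩
  p * E (λ x → ½ * (k true x + k false x)) + (1ℚ - p) * E (k a)
    ≡⟨ cong (λ e → p * e + (1ℚ - p) * E (k a)) (average (k true) (k false)) ⟩
  EcopyBit p a (λ c → E (k c))
    ∎
  where open IsLinear lin

half-double : ∀ q → ½ * (q + q) ≡ q
half-double = solve 1 (λ q → con ½ :* (q :+ q) := q) refl

Ecopy-suc : ∀ p n a x (h : Cube (suc n) → ℚ) →
  Ecopy p (suc n) (a ∷ x) h ≡ EcopyBit p a (λ c → Ecopy p n x (h ∘ (c ∷_)))
Ecopy-suc p n a x h =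
  trans (Epattern-suc p n _) (cong₂ (λ u v → p * u + (1ℚ - p) * v) freshBit keptBit)
  where
  open IsLinear (Epattern-isLinear p n)
  freshBit : Epattern p n (λ r → Eunif (suc n) (λ b → h (noisyCopy (a ∷ x) (true ∷ r) b)))
           ≡ ½ * (Ecopy p n x (h ∘ (true ∷_)) + Ecopy p n x (h ∘ (false ∷_)))
  freshBit = trans (ext (λ r → Eunif-suc n _)) (average _ _)
  keptBit : Epattern p n (λ r → Eunif (suc n) (λ b → h (noisyCopy (a ∷ x) (false ∷ r) b)))
          ≡ Ecopy p n x (h ∘ (a ∷_))
  keptBit = ext (λ r → trans (Eunif-suc n _) (half-double _))

module _ (p : ℚ) (n : ℕ) where
  open IsLinear (Eunif-isLinear n)

  Enoisy-ext : ∀ {g₁ g₂ : Cube n → Cube n → ℚ} → (∀ x y → g₁ x y ≡ g₂ x y) →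
    Enoisy p n g₁ ≡ Enoisy p n g₂
  Enoisy-ext eq = ext (λ x → IsLinear.ext (Ecopy-isLinear p n x) (eq x))

  Enoisy-+ : ∀ (g₁ g₂ : Cube n → Cube n → ℚ) →
    Enoisy p n (λ x y → g₁ x y + g₂ x y) ≡ Enoisy p n g₁ + Enoisy p n g₂
  Enoisy-+ g₁ g₂ =
    trans (ext (λ x → IsLinear.additive (Ecopy-isLinear p n x) (g₁ x) (g₂ x))) (additive _ _)

  Enoisy-* : ∀ c (g : Cube n → Cube n → ℚ) → Enoisy p n (λ x y → c * g x y) ≡ c * Enoisy p n g
  Enoisy-* c g = trans (ext (λ x → IsLinear.homogeneous (Ecopy-isLinear p n x) c (g x))) (homogeneous c _)

Enoisy-suc : ∀ p n (g : Cube (suc n) → Cube (suc n) → ℚ) →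
  Enoisy p (suc n) g ≡ EnoisyBit p (λ a c → Enoisy p n (λ x y → g (a ∷ x) (c ∷ y)))
Enoisy-suc p n g = trans (Eunif-suc n _) (cong (½ *_) (cong₂ _+_ (fromBit true) (fromBit false)))
  where
  fromBit : ∀ a → Eunif n (λ x → Ecopy p (suc n) (a ∷ x) (g (a ∷ x)))
                ≡ EcopyBit p a (λ c → Enoisy p n (λ x y → g (a ∷ x) (c ∷ y)))
  fromBit a = trans (IsLinear.ext (Eunif-isLinear n) (λ x → Ecopy-suc p n a x (g (a ∷ x))))
                    (commute-EcopyBit (Eunif-isLinear n) p a (λ c x → Ecopy p n x (g (a ∷ x) ∘ (c ∷_))))

EnoisyBit-ext : ∀ p {h₁ h₂ : Bool → Bool → ℚ} → (∀ a c → h₁ a c ≡ h₂ a c) →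
  EnoisyBit p h₁ ≡ EnoisyBit p h₂
EnoisyBit-ext p {h₁} {h₂} eq = cong₂ (λ u v → ½ * (u + v)) (EcopyBit-ext true) (EcopyBit-ext false)
  where
  EcopyBit-ext : ∀ a → EcopyBit p a (h₁ a) ≡ EcopyBit p a (h₂ a)
  EcopyBit-ext a =
    cong₂ (λ u v → p * (½ * u) + (1ℚ - p) * v) (cong₂ _+_ (eq a true) (eq a false)) (eq a a)

EnoisyBit-const : ∀ p k → EnoisyBit p (λ _ _ → k) ≡ k
EnoisyBit-const = solve 2 (λ p k →
  let copy = p :* (con ½ :* (k :+ k)) :+ (con 1ℚ :- p) :* k in con ½ :* (copy :+ copy) := k) refl

EnoisyBit-swap : ∀ p (H : Bool → Bool → Bool → Bool → ℚ) →
  EnoisyBit p (λ a c → EnoisyBit p (H a c))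
  ≡ EnoisyBit p (λ a′ c′ → EnoisyBit p (λ a c → H a c a′ c′))
EnoisyBit-swap p H = solve 17 (λ p a b c d e f g h i j k l m n o q →
  let EB = λ tt tf ft ff → con ½ :* ((p :* (con ½ :* (tt :+ tf)) :+ (con 1ℚ :- p) :* tt) :+
                                     (p :* (con ½ :* (ft :+ ff)) :+ (con 1ℚ :- p) :* ff))
  in  EB (EB a b c d) (EB e f g h) (EB i j k l) (EB m n o q)
   := EB (EB a e i m) (EB b f j n) (EB c g k o) (EB d h l q)) refl
  p (H true true true true)   (H true true true false)   (H true true false true)   (H true true false false)
    (H true false true true)  (H true false true false)  (H true false false true)  (H true false false false)
    (H false true true true)  (H false true true false)  (H false true false true)  (H false true false false)
    (H false false true true) (H false false true false) (H false false false true) (H false false false false)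

EnoisyBit-diagonal : ∀ p (h : Bool → Bool → ℚ) →
  EnoisyBit p (λ a c → eqInd a c * h a c) ≡ (1ℚ - ½ * p) * (½ * (h true true + h false false))
EnoisyBit-diagonal p h = solve 5 (λ p tt tf ft ff →
  con ½ :* ((p :* (con ½ :* (con 1ℚ :* tt :+ con 0ℚ :* tf)) :+ (con 1ℚ :- p) :* (con 1ℚ :* tt)) :+
            (p :* (con ½ :* (con 0ℚ :* ft :+ con 1ℚ :* ff)) :+ (con 1ℚ :- p) :* (con 1ℚ :* ff)))
  := (con 1ℚ :- con ½ :* p) :* (con ½ :* (tt :+ ff))) refl
  p (h true true) (h true false) (h false true) (h false false)

Enoisy-at : ∀ p n (i : Fin n) (g : Cube n → Cube n → ℚ) →
  Enoisy p n g ≡ EnoisyBit p (λ a c → Enoisy p n (λ x y → g (x [ i ]≔ a) (y [ i ]≔ c)))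
Enoisy-at p (suc n) zero g = begin
  Enoisy p (suc n) g
    ≡⟨ Enoisy-suc p n g ⟩
  EnoisyBit p (λ a c → Enoisy p n (λ x y → g (a ∷ x) (c ∷ y)))
    ≡⟨ EnoisyBit-ext p (λ a c → sym (headFixed a c)) ⟩
  EnoisyBit p (λ a c → Enoisy p (suc n) (λ x y → g (x [ zero ]≔ a) (y [ zero ]≔ c)))
    ∎
  where
  headFixed : ∀ a c → Enoisy p (suc n) (λ x y → g (x [ zero ]≔ a) (y [ zero ]≔ c))
                    ≡ Enoisy p n (λ x y → g (a ∷ x) (c ∷ y))
  headFixed a c = trans (Enoisy-suc p n (λ x y → g (x [ zero ]≔ a) (y [ zero ]≔ c)))
                        (EnoisyBit-const p (Enoisy p n (λ x y → g (a ∷ x) (c ∷ y))))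
Enoisy-at p (suc n) (suc i) g = begin
  Enoisy p (suc n) g
    ≡⟨ Enoisy-suc p n g ⟩
  EnoisyBit p (λ a c → Enoisy p n (λ x y → g (a ∷ x) (c ∷ y)))
    ≡⟨ EnoisyBit-ext p (λ a c → Enoisy-at p n i (λ x y → g (a ∷ x) (c ∷ y))) ⟩
  EnoisyBit p (λ a c → EnoisyBit p (H a c))
    ≡⟨ EnoisyBit-swap p H ⟩
  EnoisyBit p (λ a′ c′ → EnoisyBit p (λ a c → H a c a′ c′))
    ≡⟨ EnoisyBit-ext p (λ a′ c′ →
         sym (Enoisy-suc p n (λ x y → g (x [ suc i ]≔ a′) (y [ suc i ]≔ c′)))) ⟩
  EnoisyBit p (λ a′ c′ → Enoisy p (suc n) (λ x y → g (x [ suc i ]≔ a′) (y [ suc i ]≔ c′)))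
    ∎
  where
  H : Bool → Bool → Bool → Bool → ℚ
  H a c a′ c′ = Enoisy p n (λ x y → g (a ∷ x [ i ]≔ a′) (c ∷ y [ i ]≔ c′))

Enoisy-weight-at : ∀ p n (i : Fin n) (w : Bool → Bool → ℚ) (g : Cube n → Cube n → ℚ) →
  Enoisy p n (λ x y → w (lookup x i) (lookup y i) * g x y)
  ≡ EnoisyBit p (λ a c → w a c * Enoisy p n (λ x y → g (x [ i ]≔ a) (y [ i ]≔ c)))
Enoisy-weight-at p n i w g = trans (Enoisy-at p n i weighted) (EnoisyBit-ext p pull)
  where
  weighted : Cube n → Cube n → ℚ
  weighted x y = w (lookup x i) (lookup y i) * g x y

  pull : ∀ a c → Enoisy p n (λ x y → weighted (x [ i ]≔ a) (y [ i ]≔ c))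
               ≡ w a c * Enoisy p n (λ x y → g (x [ i ]≔ a) (y [ i ]≔ c))
  pull a c = trans
    (Enoisy-ext p n (λ x y → cong₂ (λ u v → w u v * g (x [ i ]≔ a) (y [ i ]≔ c))
                                   (lookup∘updateAt i x) (lookup∘updateAt i y)))
    (Enoisy-* p n (w a c) (λ x y → g (x [ i ]≔ a) (y [ i ]≔ c)))

oneMinusHalf-inverse : ∀ p → p < 1ℚ → invOneMinusHalf p * (1ℚ - ½ * p) ≡ 1ℚ
oneMinusHalf-inverse p p<1 with (1ℚ - ½ * p) ≟ 0ℚ
... | no ≢0 = *-inverseˡ (1ℚ - ½ * p) {{≢-nonZero ≢0}}
... | yes ≡0 = contradiction (subst (_< 1ℚ) p≡2 p<1) (from-no (two <? 1ℚ))
  where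
  two : ℚ
  two = (1ℚ + 1ℚ) * (1ℚ - 0ℚ)
  p≡2 : p ≡ two
  p≡2 = trans
    (solve 1 (λ p → p := (con 1ℚ :+ con 1ℚ) :* (con 1ℚ :- (con 1ℚ :- con ½ :* p))) refl p)
              (cong (λ z → (1ℚ + 1ℚ) * (1ℚ - z)) ≡0)

+-neg-inverse-cancel : ∀ a k c b → k * c ≡ 1ℚ → a + (- k) * (c * b) ≡ a - b
+-neg-inverse-cancel a k c b kc≡1 = begin
  a + (- k) * (c * b)
    ≡⟨ solve 4 (λ a k c b → a :+ (:- k) :* (c :* b) := a :- (k :* c) :* b) refl a k c b ⟩
  a - (k * c) * b
    ≡⟨ cong (λ t → a - t * b) kc≡1 ⟩
  a - 1ℚ * b
    ≡⟨ cong (λ t → a - t) (*-identityˡ b) ⟩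
  a - b
    ∎

lemma3p12 : (n : ℕ) (f : Cube n → Bool) (p : ℚ) → 0ℚ < p → p < 1ℚ →
    (i : Fin n) → Enoisy p n (eta f p i) ≡ Score n f i p
lemma3p12 n f p _ p<1 i = begin
  Enoisy p n (eta f p i)
    ≡⟨ Enoisy-ext p n (λ x y → expand (differ x y) (agree x y)) ⟩
  Enoisy p n (λ x y → differ x y + (- ι) * (agree x y * differ x y))
    ≡⟨ Enoisy-+ p n differ (λ x y → (- ι) * (agree x y * differ x y)) ⟩
  NS p n f + Enoisy p n (λ x y → (- ι) * (agree x y * differ x y))
    ≡⟨ cong (NS p n f +_) (Enoisy-* p n (- ι) (λ x y → agree x y * differ x y)) ⟩
  NS p n f + (- ι) * Enoisy p n (λ x y → agree x y * differ x y)
    ≡⟨ cong (λ t → NS p n f + (- ι) * t) agreeing ⟩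
  NS p n f + (- ι) * ((1ℚ - ½ * p) * (½ * (NS₁ + NS₀)))
    ≡⟨ +-neg-inverse-cancel (NS p n f) ι (1ℚ - ½ * p) _ (oneMinusHalf-inverse p p<1) ⟩
  Score n f i p
    ∎
  where
  ι NS₁ NS₀ : ℚ
  ι   = invOneMinusHalf p
  NS₁ = NS p n (restrict f i true)
  NS₀ = NS p n (restrict f i false)

  differ agree : Cube n → Cube n → ℚ
  differ x y = neqInd (f x) (f y)
  agree  x y = eqInd (lookup x i) (lookup y i)

  expand : ∀ d e → d * (1ℚ - ι * e) ≡ d + (- ι) * (e * d)
  expand d e = solve 3 (λ d e k → d :* (con 1ℚ :- k :* e) := d :+ (:- k) :* (e :* d)) refl d e ι

  agreeing : Enoisy p n (λ x y → agree x y * differ x y) ≡ (1ℚ - ½ * p) * (½ * (NS₁ + NS₀))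
  agreeing = trans (Enoisy-weight-at p n i eqInd differ)
    (EnoisyBit-diagonal p (λ a c → Enoisy p n (λ x y → differ (x [ i ]≔ a) (y [ i ]≔ c))))
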